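{- For any extensional $\mathbf{BI}(\_)^\bullet$-algebra $\mathcal{A}$ there is a PRO $\mathcal{C}_{\mathcal{A}}$ (a strict monoidal category whose objects are the natural numbers, with $m\otimes n=m+n$) whose arrows from $m$ to $n$ are the elements of $\mathcal{A}$ of arity $m\rightarrow n$, with composition of $a:l\to m$ and $b:m\to n$ given by $a\circ b$ and identities $\mathbf{I}$. In particular $\mathcal{C}_{\mathcal{A}}(m,1)=\mathcal{I}_{\mathcal{A}}(m)$ for all $m$.
   Context: An extensional $\mathbf{BI}(\_)^\bullet$-algebra is a set $\mathcal{A}$ with a binary application written by juxtaposition (left associative), elements $\mathbf{B},\mathbf{I}$ and a function $a\mapsto a^\bullet$ such that for all $a,b,c$: $\mathbf{I}\,a=a$; $\mathbf{B}\,a\,b\,c=a\,(b\,c)$; $a^\bullet\,b=b\,a$; $\mathbf{B}\,\mathbf{I}=\mathbf{I}$; $(a\,b)^\bullet=\mathbf{B}\,b^\bullet\,(\mathbf{B}\,a^\bullet\,\mathbf{B})$; $\mathbf{B}\,\mathbf{B}^\bullet\,(\mathbf{B}\,\mathbf{B}\,(\mathbf{B}\,\mathbf{B}\,\mathbf{B}))=\mathbf{B}\,(\mathbf{B}\,\mathbf{B})\,\mathbf{B}$; $\mathbf{B}\,\mathbf{I}^\bullet\,\mathbf{B}=\mathbf{I}$; $\mathbf{B}\,a^{\bullet\bullet}\,\mathbf{B}=\mathbf{B}\,(\mathbf{B}\,a^\bullet)\,\mathbf{B}$. Write $a\circ b=\mathbf{B}\,a\,b$ (associative with unit $\mathbf{I}$).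 Let $\mathbf{B}^0=\mathbf{I}$, $\mathbf{B}^{k+1}=\mathbf{B}\circ\mathbf{B}^k$. An element $a$ is of arity $m\rightarrow n$ when $a^\bullet\circ\mathbf{B}^{m+1}=(\mathbf{B}\,a)\circ\mathbf{B}^n$. The internal operad has $\mathcal{I}_{\mathcal{A}}(m)=\{a^\bullet\circ\mathbf{B}^m\mid a\in\mathcal{A}\}$. -}

module Defs where

open import Data.Nat using (ℕ; zero; suc; _+_)
open import Data.Product using (∃)
open import Relation.Binary.PropositionalEquality using (_≡_)

-- An extensional BI(_)•-algebra (equality is propositional equality on the carrier).
record BIAlg : Set₁ where
  infixl 9 _·_
  infix 10 _•
  field
    Carrier : Set
    _·_     : Carrier → Carrier → Carrier
    B I     : Carrier
    _•      : Carrier → Carrier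
    I-ax    : ∀ a → I · a ≡ a
    B-ax    : ∀ a b c → B · a · b · c ≡ a · (b · c)
    •-ax    : ∀ a b → (a •) · b ≡ b · a
    BI≡I    : B · I ≡ I
    •-app   : ∀ a b → (a · b) • ≡ B · (b •) · (B · (a •) · B)
    B•-ax   : B · (B •) · (B · B · (B · B · B)) ≡ B · (B · B) · B
    BI•B    : B · (I •) · B ≡ I
    ••-ax   : ∀ a → B · ((a •) •) · B ≡ B · (B · (a •)) · B

module _ (A : BIAlg) where
  open BIAlg A

  infixr 9 _∘ᴮ_
  _∘ᴮ_ : Carrier → Carrier → Carrier
  a ∘ᴮ b = B · a · b

  Bpow : ℕ → Carrier
  Bpow zero    = I
  Bpow (suc k) = B ∘ᴮ Bpow k

  HasArity : Carrier → ℕ → ℕ → Set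
  HasArity a m n = ((a •) ∘ᴮ Bpow (suc m)) ≡ ((B · a) ∘ᴮ Bpow n)

  InOperad : ℕ → Carrier → Set
  InOperad m x = ∃ λ c → x ≡ ((c •) ∘ᴮ Bpow m)

  record Hom (m n : ℕ) : Set where
    constructor _,_
    field
      elt   : Carrier
      arity : HasArity elt m n
  open Hom public
  infixr 4 _,_

  arr : ∀ m n a → HasArity a m n → Hom m n
  arr m n a p = a , p

  -- The data and laws making C_A (objects ℕ, arrows Hom, composition ∘ᴮ,
  -- identities I) a PRO with m ⊗ n = m + n.
  -- Equalities of arrows are equalities of the underlying elements.
  record IsArityPRO : Set where
    field
      id-arity   : ∀ m → HasArity I m m
      comp-arity : ∀ {l m n : ℕ} {a b : Carrier} → HasArity a l m → HasArity b m n
                   → HasArity (a ∘ᴮ b) l n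
      ∘-assoc : ∀ {k l m n} (f : Hom k l) (g : Hom l m) (h : Hom m n)
                → ((elt f ∘ᴮ elt g) ∘ᴮ elt h) ≡ (elt f ∘ᴮ (elt g ∘ᴮ elt h))
      ∘-idˡ   : ∀ {m n} (f : Hom m n) → (I ∘ᴮ elt f) ≡ elt f
      ∘-idʳ   : ∀ {m n} (f : Hom m n) → (elt f ∘ᴮ I) ≡ elt f
      _⊗_     : ∀ {m n m' n'} → Hom m n → Hom m' n' → Hom (m + m') (n + n')
      ⊗-id    : ∀ m n → elt (arr m m I (id-arity m) ⊗ arr n n I (id-arity n)) ≡ I
      ⊗-∘     : ∀ {l m n l' m' n'} (f : Hom l m) (g : Hom m n)
                  (f' : Hom l' m') (g' : Hom m' n')
                → elt (arr l n (elt f ∘ᴮ elt g) (comp-arity {l} {m} {n} (arity f) (arity g))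
                       ⊗ arr l' n' (elt f' ∘ᴮ elt g') (comp-arity {l'} {m'} {n'} (arity f') (arity g')))
                  ≡ (elt (f ⊗ f') ∘ᴮ elt (g ⊗ g'))
      ⊗-assoc : ∀ {m n m' n' m'' n''} (f : Hom m n) (g : Hom m' n') (h : Hom m'' n'')
                → elt ((f ⊗ g) ⊗ h) ≡ elt (f ⊗ (g ⊗ h))
      ⊗-unitˡ : ∀ {m n} (f : Hom m n) → elt (arr 0 0 I (id-arity 0) ⊗ f) ≡ elt f
      ⊗-unitʳ : ∀ {m n} (f : Hom m n) → elt (f ⊗ arr 0 0 I (id-arity 0)) ≡ elt f

{-# OPTIONS --safe #-}
-- Composition x ∘ y = B x y is associative because the B•-axiom makes B ·_ a
-- ∘-homomorphism, and I is a two-sided unit by the axioms for B I and B I•.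
-- The ••-axiom lets a• slide past any x (x ∘ a• = a• ∘ B x); with it one shows
-- that arities compose, shift (B ·_ turns m → n into 1+m → 1+n) and widen
-- (_∘ B^k turns m → n into m+k → n+k).  The tensor of f : m → n and g : m' → n'
-- is f ∘ B^n g; applied pointwise, the arity equation of g is the interchange
-- law (B^m x) ∘ g = g ∘ (B^n x), which gives bifunctoriality.  Finally every
-- a : m → 1 equals (a I)• ∘ B^m, and conversely c• : 0 → 1 and B^m : 1+m → 1
-- put every c• ∘ B^m in C_A(m,1).
module Submission where

open import Defs
open import Data.Nat using (ℕ; zero; suc; _+_)
open import Data.Product using (_×_; _,_)
open import Function.Base using (_⟨_⟩_)
open import Relation.Binary.PropositionalEquality
open ≡-Reasoning

module ArityPRO (A : BIAlg) where
  open BIAlg A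

  infixr 8 _∘_
  _∘_ : Carrier → Carrier → Carrier
  _∘_ = _∘ᴮ_ A

  infix 10 B^_
  B^_ : ℕ → Carrier
  B^_ = Bpow A

  ∘-apply : ∀ x y z → (x ∘ y) · z ≡ x · (y · z)
  ∘-apply = B-ax

  B·B·∘B≡B∘B· : ∀ a → B · (B · a) ∘ B ≡ B ∘ B · a
  B·B·∘B≡B∘B· a = begin
      B · (B · (B · a)) · B
    ≡⟨ cong (λ t → B · t · B) (sym (B-ax B B a)) ⟩
      B · (B · B · B · a) · B
    ≡⟨ sym (•-ax B (B · (B · B · B · a))) ⟩
      (B •) · (B · (B · B · B · a))
    ≡⟨ cong (B • ·_) (sym (B-ax B (B · B · B) a)) ⟩
      (B •) · (B · B · (B · B · B) · a)
    ≡⟨ sym (B-ax (B •) (B · B · (B · B · B)) a) ⟩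
      B · (B •) · (B · B · (B · B · B)) · a
    ≡⟨ cong (_· a) B•-ax ⟩
      B · (B · B) · B · a
    ≡⟨ B-ax (B · B) B a ⟩
      B · B · (B · a) ∎

  B·-homo-∘ : ∀ a b → B · (a ∘ b) ≡ B · a ∘ B · b
  B·-homo-∘ a b = begin
      B · (B · a · b)
    ≡⟨ sym (B-ax B (B · a) b) ⟩
      B · B · (B · a) · b
    ≡⟨ cong (_· b) (sym (B·B·∘B≡B∘B· a)) ⟩
      B · (B · (B · a)) · B · b
    ≡⟨ B-ax (B · (B · a)) B b ⟩
      B · (B · a) · (B · b) ∎

  ∘-assoc : ∀ a b c → (a ∘ b) ∘ c ≡ a ∘ (b ∘ c)
  ∘-assoc a b c = cong (_· c) (B·-homo-∘ a b) ⟨ trans ⟩ B-ax (B · a) (B · b) c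

  ∘-identityˡ : ∀ x → I ∘ x ≡ x
  ∘-identityˡ x = cong (_· x) BI≡I ⟨ trans ⟩ I-ax x

  ∘-identityʳ : ∀ x → x ∘ I ≡ x
  ∘-identityʳ x = begin
      B · x · I
    ≡⟨ sym (•-ax I (B · x)) ⟩
      (I •) · (B · x)
    ≡⟨ sym (B-ax (I •) B x) ⟩
      B · (I •) · B · x
    ≡⟨ cong (_· x) BI•B ⟩
      I · x
    ≡⟨ I-ax x ⟩
      x ∎

  ∘•≡•∘B· : ∀ x a → x ∘ a • ≡ a • ∘ B · x
  ∘•≡•∘B· x a = begin
      B · x · (a •)
    ≡⟨ sym (•-ax (a •) (B · x)) ⟩
      ((a •) •) · (B · x)
    ≡⟨ sym (B-ax ((a •) •) B x) ⟩
      B · ((a •) •) · B · x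
    ≡⟨ cong (_· x) (••-ax a) ⟩
      B · (B · (a •)) · B · x
    ≡⟨ B-ax (B · (a •)) B x ⟩
      B · (a •) · (B · x) ∎

  [B·]•∘B∘B≡B∘•∘B : ∀ g → (B · g) • ∘ B ∘ B ≡ B ∘ g • ∘ B
  [B·]•∘B∘B≡B∘•∘B g = begin
      (B · g) • ∘ B ∘ B
    ≡⟨ cong (_∘ B ∘ B) (•-app B g) ⟩
      (g • ∘ B • ∘ B) ∘ B ∘ B
    ≡⟨ ∘-assoc _ _ _ ⟨ trans ⟩ cong (g • ∘_) (∘-assoc _ _ _) ⟩
      g • ∘ B • ∘ B ∘ B ∘ B
    ≡⟨ cong (g • ∘_) B•-ax ⟩
      g • ∘ B · B ∘ B
    ≡⟨ sym (∘-assoc _ _ _) ⟩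
      (g • ∘ B · B) ∘ B
    ≡⟨ cong (_∘ B) (sym (∘•≡•∘B· B g)) ⟩
      (B ∘ g •) ∘ B
    ≡⟨ ∘-assoc _ _ _ ⟩
      B ∘ g • ∘ B ∎

  B^-+ : ∀ j k → B^ (j + k) ≡ B^ j ∘ B^ k
  B^-+ zero    k = sym (∘-identityˡ (B^ k))
  B^-+ (suc j) k = cong (B ∘_) (B^-+ j k) ⟨ trans ⟩ sym (∘-assoc _ _ _)

  B^-·I : ∀ k → B^ k · I ≡ I
  B^-·I zero    = I-ax I
  B^-·I (suc k) = B-ax B (B^ k) I ⟨ trans ⟩ cong (B ·_) (B^-·I k) ⟨ trans ⟩ BI≡I

  B^-homo-∘ : ∀ k x y → B^ k · (x ∘ y) ≡ B^ k · x ∘ B^ k · y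
  B^-homo-∘ zero    x y = I-ax _ ⟨ trans ⟩ sym (cong₂ _∘_ (I-ax x) (I-ax y))
  B^-homo-∘ (suc k) x y = begin
      B^ suc k · (x ∘ y)
    ≡⟨ B-ax B (B^ k) _ ⟩
      B · (B^ k · (x ∘ y))
    ≡⟨ cong (B ·_) (B^-homo-∘ k x y) ⟩
      B · (B^ k · x ∘ B^ k · y)
    ≡⟨ B·-homo-∘ _ _ ⟩
      B · (B^ k · x) ∘ B · (B^ k · y)
    ≡⟨ sym (cong₂ _∘_ (B-ax B (B^ k) x) (B-ax B (B^ k) y)) ⟩
      B^ suc k · x ∘ B^ suc k · y ∎

  Arity : Carrier → ℕ → ℕ → Set
  Arity = HasArity A

  Arity-I : ∀ m → Arity I m m
  Arity-I m = begin
      I • ∘ B ∘ B^ m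
    ≡⟨ sym (∘-assoc _ _ _) ⟩
      (I • ∘ B) ∘ B^ m
    ≡⟨ cong (_∘ B^ m) (BI•B ⟨ trans ⟩ sym BI≡I) ⟩
      B · I ∘ B^ m ∎

  Arity-widen : ∀ {a m n} → Arity a m n → ∀ k → Arity a (m + k) (n + k)
  Arity-widen {a} {m} {n} h k = begin
      a • ∘ B^ (suc m + k)
    ≡⟨ cong (a • ∘_) (B^-+ (suc m) k) ⟩
      a • ∘ B^ suc m ∘ B^ k
    ≡⟨ sym (∘-assoc _ _ _) ⟩
      (a • ∘ B^ suc m) ∘ B^ k
    ≡⟨ cong (_∘ B^ k) h ⟩
      (B · a ∘ B^ n) ∘ B^ k
    ≡⟨ ∘-assoc _ _ _ ⟩
      B · a ∘ B^ n ∘ B^ k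
    ≡⟨ cong (B · a ∘_) (sym (B^-+ n k)) ⟩
      B · a ∘ B^ (n + k) ∎

  Arity-shift : ∀ {g m n} → Arity g m n → Arity (B · g) (suc m) (suc n)
  Arity-shift {g} {m} {n} h = begin
      (B · g) • ∘ B ∘ B ∘ B^ m
    ≡⟨ cong ((B · g) • ∘_) (sym (∘-assoc _ _ _)) ⟨ trans ⟩ sym (∘-assoc _ _ _) ⟩
      ((B · g) • ∘ B ∘ B) ∘ B^ m
    ≡⟨ cong (_∘ B^ m) ([B·]•∘B∘B≡B∘•∘B g) ⟩
      (B ∘ g • ∘ B) ∘ B^ m
    ≡⟨ ∘-assoc _ _ _ ⟨ trans ⟩ cong (B ∘_) (∘-assoc _ _ _) ⟩
      B ∘ g • ∘ B^ suc m
    ≡⟨ cong (B ∘_) h ⟩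
      B ∘ B · g ∘ B^ n
    ≡⟨ sym (∘-assoc _ _ _) ⟩
      (B ∘ B · g) ∘ B^ n
    ≡⟨ cong (_∘ B^ n) (sym (B·B·∘B≡B∘B· g)) ⟩
      (B · (B · g) ∘ B) ∘ B^ n
    ≡⟨ ∘-assoc _ _ _ ⟩
      B · (B · g) ∘ B^ suc n ∎

  Arity-B^· : ∀ {g m n} → Arity g m n → ∀ k → Arity (B^ k · g) (k + m) (k + n)
  Arity-B^· {g} {m} {n} h zero    = subst (λ x → Arity x m n) (sym (I-ax g)) h
  Arity-B^· {g} {m} {n} h (suc k) =
    subst (λ x → Arity x (suc (k + m)) (suc (k + n))) (sym (B-ax B (B^ k) g))
          (Arity-shift {m = k + m} {k + n} (Arity-B^· h k))

  Arity-∘ : ∀ {l m n : ℕ} {a b : Carrier} → Arity a l m → Arity b m n → Arity (a ∘ b) l n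
  Arity-∘ {l} {m} {n} {a} {b} ha hb = begin
      (a ∘ b) • ∘ B^ suc l
    ≡⟨ cong (_∘ B^ suc l) (•-app (B · a) b) ⟩
      (b • ∘ (B · a) • ∘ B) ∘ B^ suc l
    ≡⟨ ∘-assoc _ _ _ ⟨ trans ⟩ cong (b • ∘_) (∘-assoc _ _ _) ⟩
      b • ∘ (B · a) • ∘ B^ suc (suc l)
    ≡⟨ cong (b • ∘_) (Arity-shift {m = l} {m} ha) ⟩
      b • ∘ B · (B · a) ∘ B^ suc m
    ≡⟨ sym (∘-assoc _ _ _) ⟩
      (b • ∘ B · (B · a)) ∘ B^ suc m
    ≡⟨ cong (_∘ B^ suc m) (sym (∘•≡•∘B· (B · a) b)) ⟩
      (B · a ∘ b •) ∘ B^ suc m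
    ≡⟨ ∘-assoc _ _ _ ⟩
      B · a ∘ b • ∘ B^ suc m
    ≡⟨ cong (B · a ∘_) hb ⟩
      B · a ∘ B · b ∘ B^ n
    ≡⟨ sym (∘-assoc _ _ _) ⟩
      (B · a ∘ B · b) ∘ B^ n
    ≡⟨ cong (_∘ B^ n) (sym (B·-homo-∘ a b)) ⟩
      B · (a ∘ b) ∘ B^ n ∎

  Arity⇒interchange : ∀ {g m n} → Arity g m n → ∀ x → B^ m · x ∘ g ≡ g ∘ B^ n · x
  Arity⇒interchange {g} {m} {n} h x = begin
      B · (B^ m · x) · g
    ≡⟨ cong (_· g) (sym (B-ax B (B^ m) x)) ⟩
      B^ suc m · x · g
    ≡⟨ sym (•-ax g _) ⟩
      (g •) · (B^ suc m · x)
    ≡⟨ sym (∘-apply _ _ _) ⟩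
      (g • ∘ B^ suc m) · x
    ≡⟨ cong (_· x) h ⟩
      (B · g ∘ B^ n) · x
    ≡⟨ ∘-apply _ _ _ ⟩
      B · g · (B^ n · x) ∎

  Arity-• : ∀ c → Arity (c •) 0 1
  Arity-• c = begin
      (c •) • ∘ B ∘ I
    ≡⟨ cong ((c •) • ∘_) (∘-identityʳ B) ⟩
      (c •) • ∘ B
    ≡⟨ ••-ax c ⟩
      B · (c •) ∘ B
    ≡⟨ cong (B · (c •) ∘_) (sym (∘-identityʳ B)) ⟩
      B · (c •) ∘ B ∘ I ∎

  Arity-B : Arity B 2 1
  Arity-B = begin
      B • ∘ B ∘ B ∘ B ∘ I
    ≡⟨ cong (λ t → B • ∘ B ∘ B ∘ t) (∘-identityʳ B) ⟩
      B • ∘ B ∘ B ∘ B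
    ≡⟨ B•-ax ⟩
      B · B ∘ B
    ≡⟨ cong (B · B ∘_) (sym (∘-identityʳ B)) ⟩
      B · B ∘ B ∘ I ∎

  Arity-B^ : ∀ m → Arity (B^ m) (suc m) 1
  Arity-B^ zero    = Arity-I 1
  Arity-B^ (suc m) = Arity-∘ {suc (suc m)} {suc m} {1} (Arity-widen {m = 2} {1} Arity-B m) (Arity-B^ m)

  _⊗_ : ∀ {m n m' n'} → Hom A m n → Hom A m' n' → Hom A (m + m') (n + n')
  _⊗_ {m} {n} {m'} {n'} f g =
    elt f ∘ B^ n · elt g ,
    Arity-∘ {m + m'} {n + m'} {n + n'}
            (Arity-widen {m = m} {n} (arity f) m') (Arity-B^· {m = m'} {n'} (arity g) n)

  ⊗-∘ : ∀ {l m n l' m' n'}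
        (f : Hom A l m) (g : Hom A m n) (f' : Hom A l' m') (g' : Hom A m' n')
      → (elt f ∘ elt g) ∘ B^ n · (elt f' ∘ elt g')
        ≡ (elt f ∘ B^ m · elt f') ∘ (elt g ∘ B^ n · elt g')
  ⊗-∘ {m = m} {n} (f , _) (g , g-arity) (f' , _) (g' , _) = begin
      (f ∘ g) ∘ B^ n · (f' ∘ g')
    ≡⟨ cong ((f ∘ g) ∘_) (B^-homo-∘ n f' g') ⟩
      (f ∘ g) ∘ B^ n · f' ∘ B^ n · g'
    ≡⟨ ∘-assoc _ _ _ ⟨ trans ⟩ cong (f ∘_) (sym (∘-assoc _ _ _)) ⟩
      f ∘ (g ∘ B^ n · f') ∘ B^ n · g'
    ≡⟨ cong (λ t → f ∘ t ∘ B^ n · g') (sym (Arity⇒interchange {m = m} {n} g-arity f')) ⟩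
      f ∘ (B^ m · f' ∘ g) ∘ B^ n · g'
    ≡⟨ cong (f ∘_) (∘-assoc _ _ _) ⟨ trans ⟩ sym (∘-assoc _ _ _) ⟩
      (f ∘ B^ m · f') ∘ g ∘ B^ n · g' ∎

  ⊗-assoc : ∀ {m n m' n' m'' n''} (f : Hom A m n) (g : Hom A m' n') (h : Hom A m'' n'')
          → elt ((f ⊗ g) ⊗ h) ≡ elt (f ⊗ (g ⊗ h))
  ⊗-assoc {n = n} {n' = n'} (f , _) (g , _) (h , _) = begin
      (f ∘ B^ n · g) ∘ B^ (n + n') · h
    ≡⟨ ∘-assoc _ _ _ ⟩
      f ∘ B^ n · g ∘ B^ (n + n') · h
    ≡⟨ cong (λ t → f ∘ B^ n · g ∘ t) (cong (_· h) (B^-+ n n') ⟨ trans ⟩ ∘-apply _ _ _) ⟩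
      f ∘ B^ n · g ∘ B^ n · (B^ n' · h)
    ≡⟨ cong (f ∘_) (sym (B^-homo-∘ n _ _)) ⟩
      f ∘ B^ n · (g ∘ B^ n' · h) ∎

  isArityPRO : IsArityPRO A
  isArityPRO = record
    { id-arity   = Arity-I
    ; comp-arity = λ {l} {m} {n} → Arity-∘ {l} {m} {n}
    ; ∘-assoc    = λ f g h → ∘-assoc (elt f) (elt g) (elt h)
    ; ∘-idˡ      = λ f → ∘-identityˡ (elt f)
    ; ∘-idʳ      = λ f → ∘-identityʳ (elt f)
    ; _⊗_        = _⊗_
    ; ⊗-id       = λ m n → cong (I ∘_) (B^-·I m) ⟨ trans ⟩ ∘-identityˡ I
    ; ⊗-∘        = ⊗-∘
    ; ⊗-assoc    = ⊗-assoc
    ; ⊗-unitˡ    = λ f → ∘-identityˡ _ ⟨ trans ⟩ I-ax (elt f)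
    ; ⊗-unitʳ    = λ {m} {n} f → cong (elt f ∘_) (B^-·I n) ⟨ trans ⟩ ∘-identityʳ (elt f)
    }

  Arity⇒InOperad : ∀ m a → Arity a m 1 → InOperad A m a
  Arity⇒InOperad m a h = a · I , sym (begin
      (a · I) • ∘ B^ m
    ≡⟨ cong (_∘ B^ m) (•-app a I) ⟩
      (I • ∘ a • ∘ B) ∘ B^ m
    ≡⟨ ∘-assoc _ _ _ ⟨ trans ⟩ cong (I • ∘_) (∘-assoc _ _ _) ⟩
      I • ∘ a • ∘ B^ suc m
    ≡⟨ cong (I • ∘_) (h ⟨ trans ⟩ cong (B · a ∘_) (∘-identityʳ B)) ⟩
      I • ∘ B · a ∘ B
    ≡⟨ sym (∘-assoc _ _ _) ⟩
      (I • ∘ B · a) ∘ B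
    ≡⟨ cong (_∘ B) (sym (∘•≡•∘B· a I)) ⟩
      (a ∘ I •) ∘ B
    ≡⟨ ∘-assoc _ _ _ ⟩
      a ∘ I • ∘ B
    ≡⟨ cong (a ∘_) BI•B ⟨ trans ⟩ ∘-identityʳ a ⟩
      a ∎)

  InOperad⇒Arity : ∀ m a → InOperad A m a → Arity a m 1
  InOperad⇒Arity m a (c , a≡c•∘B^m) = subst (λ x → Arity x m 1) (sym a≡c•∘B^m)
    (Arity-∘ {m} {suc m} {1} (Arity-widen {m = 0} {1} (Arity-• c) m) (Arity-B^ m))

theorem4p4 : (A : BIAlg)
    → IsArityPRO A
    × (∀ (m : ℕ) (a : BIAlg.Carrier A)
    → (HasArity A a m 1 → InOperad A m a) × (InOperad A m a → HasArity A a m 1))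
theorem4p4 A = isArityPRO , λ m a → Arity⇒InOperad m a , InOperad⇒Arity m a
  where open ArityPRO A
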